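{- In the additive group $\mathbb{Z}$: (1) for any integer $n\geq3$, the set $S_1=\{n^k: k\geq0\}$ is part of a co-minimal pair, i.e., there exists $S_1'\subseteq\mathbb{Z}$ such that $(S_1,S_1')$ is a co-minimal pair; (2) the set $S_2=\{2^k+k: k\geq0\}$ is part of a co-minimal pair, i.e., there exists $S_2'\subseteq\mathbb{Z}$ such that $(S_2,S_2')$ is a co-minimal pair.
   Context: Nonempty subsets $A,B\subseteq\mathbb{Z}$ form a co-minimal pair if $A+B=\mathbb{Z}$, $A'+B\neq\mathbb{Z}$ for every nonempty proper subset $A'\subsetneq A$, and $A+B'\neq\mathbb{Z}$ for every nonempty proper subset $B'\subsetneq B$. -}

module Defs where

open import Data.Integer using (ℤ; _+_; +_)
open import Data.Nat using (ℕ) renaming (_+_ to _+ℕ_; _^_ to _^ℕ_)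
open import Data.Product using (Σ; ∃; _×_; _,_)
open import Relation.Nullary using (¬_)
open import Relation.Binary.PropositionalEquality using (_≡_)

Subset : Set₁
Subset = ℤ → Set

_⊆_ : Subset → Subset → Set
A ⊆ B = ∀ z → A z → B z

Nonempty : Subset → Set
Nonempty A = ∃ λ z → A z

_⊊_ : Subset → Subset → Set
A' ⊊ A = A' ⊆ A × ∃ λ z → A z × ¬ A' z

SumsetIsℤ : Subset → Subset → Set
SumsetIsℤ A B = ∀ z → ∃ λ a → ∃ λ b → A a × B b × z ≡ a + b

CoMinimalPair : Subset → Subset → Set₁
CoMinimalPair A B =
  Nonempty A × Nonempty B × SumsetIsℤ A B
  × (∀ (A' : Subset) → Nonempty A' → A' ⊊ A → ¬ SumsetIsℤ A' B)
  × (∀ (B' : Subset) → Nonempty B' → B' ⊊ B → ¬ SumsetIsℤ A B')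

Powers : ℕ → Subset
Powers n z = ∃ λ (k : ℕ) → z ≡ + (n ^ℕ k)

PowersOfTwoPlusIndex : Subset
PowersOfTwoPlusIndex z = ∃ λ (k : ℕ) → z ≡ + (2 ^ℕ k +ℕ k)

{-# OPTIONS --safe #-}
-- Let a₀ < a₁ < ⋯ have gaps E j = a (j + 1) − a j that are nondecreasing and exceed j.
-- Each integer w gets an anchor κ w (0 if w ≥ 0, otherwise the least K with 2∣w∣ < E K)
-- and a shift b w = w − a (κ w), so that w = a (κ w) + b w.  Say w covers z if
-- z = a i + b w with i ≠ κ w; the choice of anchors forces ∣w∣ < ∣z∣.  Select integers
-- greedily, in an order refining ∣·∣, skipping those covered by an earlier selected one,
-- and let B be the shifts of the selected integers.  Every z is selected or covered, so
-- A + B = ℤ; a selected t has t = a (κ t) + b t as its only representation, so no element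
-- of B can be dropped, and no a k either once k is the anchor of a selected integer.
-- For k > 0 that integer is −Q for some Q with κ (−Q) = k which no −q with 0 < q < Q
-- covers; finding such Q is the arithmetic done for n^k (Q = n^(k+1) − 1) and 2^k + k.

module Submission where

open import Defs

open import Data.Bool.Base using (Bool; true; not; T)
open import Data.Empty using (⊥-elim)
open import Data.Integer.Base as ℤ using (ℤ; +_; -[1+_]; ∣_∣)
import Data.Integer.Properties as ℤ
open import Data.Integer.Tactic.RingSolver using (solve-∀)
open import Data.List.Base using (_∷_; [])
open import Data.Nat.Base using (ℕ; zero; suc; pred; _+_; _*_; _^_; _≤_; _<_; _≥_; z≤n; s≤s; s≤s⁻¹)
open import Data.Nat.Induction using (<-wellFounded)
open import Data.Nat.Properties
open import Data.Nat.Tactic.RingSolver using (solve)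
open import Data.Product using (Σ; ∃; _×_; _,_; proj₁; proj₂)
open import Data.Sum using (_⊎_; inj₁; inj₂)
open import Data.Unit.Base using (tt)
open import Function.Base using (_∘_)
open import Function.Bundles using (_↔_; Inverse; mk↔ₛ′; _⇔_; mk⇔; Equivalence)
open import Induction.WellFounded using (Acc; acc)
open import Relation.Binary.Definitions using (Decidable; tri<; tri≈; tri>)
open import Relation.Binary.PropositionalEquality
open import Relation.Nullary using (¬_; Dec; yes; no; does; ¬?; contradiction)
open import Relation.Nullary.Decidable using (T?; _×-dec_; does-⇔; map′)
import Relation.Unary as U

least : ∀ {p} {P : ℕ → Set p} → U.Decidable P → ∀ n → P n → ∃ λ m → P m × (∀ {k} → P k → m ≤ k)
least {P = P} P? n Pn = go n Pn (<-wellFounded n)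
  where
  go : ∀ n → P n → Acc _<_ n → ∃ λ m → P m × (∀ {k} → P k → m ≤ k)
  go n Pn (acc smaller) with anyUpTo? P? n
  ... | yes (k , k<n , Pk) = go k Pk (smaller k<n)
  ... | no none            = n , Pn , λ {k} Pk → ≮⇒≥ λ k<n → none (k , k<n , Pk)

rank : ℤ → ℕ
rank (+ n)    = 2 * n
rank -[1+ n ] = suc (2 * n)

stepAway : ℤ → ℤ
stepAway (+ n)    = + suc n
stepAway -[1+ n ] = -[1+ suc n ]

unrank : ℕ → ℤ
unrank zero          = + 0
unrank (suc zero)    = -[1+ 0 ]
unrank (suc (suc r)) = stepAway (unrank r)

rank-stepAway : ∀ z → rank (stepAway z) ≡ 2 + rank z
rank-stepAway (+ n)    = *-suc 2 n
rank-stepAway -[1+ n ] = cong suc (*-suc 2 n)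

rank-unrank : ∀ r → rank (unrank r) ≡ r
rank-unrank zero          = refl
rank-unrank (suc zero)    = refl
rank-unrank (suc (suc r)) = trans (rank-stepAway (unrank r)) (cong (suc ∘ suc) (rank-unrank r))

unrank-even : ∀ n → unrank (2 * n) ≡ + n
unrank-even zero    = refl
unrank-even (suc n) = trans (cong unrank (*-suc 2 n)) (cong stepAway (unrank-even n))

unrank-odd : ∀ n → unrank (suc (2 * n)) ≡ -[1+ n ]
unrank-odd zero    = refl
unrank-odd (suc n) = trans (cong (unrank ∘ suc) (*-suc 2 n)) (cong stepAway (unrank-odd n))

unrank-rank : ∀ z → unrank (rank z) ≡ z
unrank-rank (+ n)    = unrank-even n
unrank-rank -[1+ n ] = unrank-odd n

ℤ↔ℕ : ℤ ↔ ℕ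
ℤ↔ℕ = mk↔ₛ′ rank unrank rank-unrank unrank-rank

rank≤2∣∣ : ∀ z → rank z ≤ 2 * ∣ z ∣
rank≤2∣∣ (+ n)    = ≤-refl
rank≤2∣∣ -[1+ n ] = ≤-trans (n≤1+n _) (≤-reflexive (sym (*-suc 2 n)))

2∣∣≤1+rank : ∀ z → 2 * ∣ z ∣ ≤ suc (rank z)
2∣∣≤1+rank (+ n)    = n≤1+n _
2∣∣≤1+rank -[1+ n ] = ≤-reflexive (*-suc 2 n)

rank-mono-∣∣ : ∀ {w z} → ∣ w ∣ < ∣ z ∣ → rank w < rank z
rank-mono-∣∣ {w} {z} lt = s≤s⁻¹ (begin-strict
  suc (rank w)      ≤⟨ s≤s (rank≤2∣∣ w) ⟩
  suc (2 * ∣ w ∣)    <⟨ ≤-reflexive (sym (*-suc 2 ∣ w ∣)) ⟩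
  2 * suc ∣ w ∣      ≤⟨ *-monoʳ-≤ 2 lt ⟩
  2 * ∣ z ∣          ≤⟨ 2∣∣≤1+rank z ⟩
  suc (rank z)      ∎)
  where open ≤-Reasoning

T-not-does : ∀ {a} {A : Set a} (d : Dec A) → T (not (does d)) ⇔ (¬ A)
T-not-does (yes a)  = mk⇔ (λ ()) (λ ¬a → ¬a a)
T-not-does (no ¬a) = mk⇔ (λ _ → ¬a) (λ _ → tt)

module Greedy {X : Set} (enumeration : X ↔ ℕ) {R : X → X → Set} (R? : Decidable R) where

  open Inverse enumeration using (strictlyInverseˡ; strictlyInverseʳ)
    renaming (to to index; from to element)

  private
    KilledBy : (ℕ → Bool) → ℕ → Set
    KilledBy s r = ∃ λ r' → r' < r × T (s r') × R (element r') (element r)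

    killed? : ∀ s r → Dec (KilledBy s r)
    killed? s r = anyUpTo? (λ r' → T? (s r') ×-dec R? (element r') (element r)) r

    killed-cong : ∀ {s s'} r → (∀ {r'} → r' < r → s r' ≡ s' r') →
                  does (killed? s r) ≡ does (killed? s' r)
    killed-cong {s} {s'} r s≗s' =
      does-⇔ (mk⇔ (transport s≗s') (transport (sym ∘ s≗s'))) (killed? s r) (killed? s' r)
      where
      transport : ∀ {s s'} → (∀ {r'} → r' < r → s r' ≡ s' r') → KilledBy s r → KilledBy s' r
      transport eq (r' , r'<r , sr' , Rr'r) = r' , r'<r , subst T (eq r'<r) sr' , Rr'r

    -- The fuel f makes the course-of-values recursion structural.
    selectedWithin : ℕ → ℕ → Bool
    selectedWithin zero    r = true
    selectedWithin (suc f) r = not (does (killed? (selectedWithin f) r))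

    selectedWithin-stable : ∀ {f g r} → r < f → r < g → selectedWithin f r ≡ selectedWithin g r
    selectedWithin-stable {suc f} {suc g} {r} (s≤s r≤f) (s≤s r≤g) = cong not (killed-cong r λ r'<r →
      selectedWithin-stable (<-≤-trans r'<r r≤f) (<-≤-trans r'<r r≤g))

    selected : ℕ → Bool
    selected r = selectedWithin (suc r) r

    selected⇔unkilled : ∀ r → T (selected r) ⇔ (¬ KilledBy selected r)
    selected⇔unkilled r = subst (λ b → T b ⇔ (¬ KilledBy selected r))
      (sym (cong not (killed-cong r λ r'<r → selectedWithin-stable r'<r ≤-refl)))
      (T-not-does (killed? selected r))

  record Selected (x : X) : Set where
    constructor chosen
    field isChosen : T (selected (index x))

  selected? : U.Decidable Selected
  selected? x = map′ chosen Selected.isChosen (T? (selected (index x)))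

  private
    killer : ∀ {w z} → index w < index z → Selected w → R w z → KilledBy selected (index z)
    killer {w} {z} w<z (chosen Sw) Rwz =
      index w , w<z , Sw , subst₂ R (sym (strictlyInverseʳ w)) (sym (strictlyInverseʳ z)) Rwz

  selected-free : ∀ {w z} → Selected z → index w < index z → Selected w → ¬ R w z
  selected-free {z = z} (chosen Sz) w<z Sw Rwz =
    Equivalence.to (selected⇔unkilled (index z)) Sz (killer w<z Sw Rwz)

  selected-intro : ∀ {z} → (∀ {w} → index w < index z → Selected w → ¬ R w z) → Selected z
  selected-intro {z} unkilled = chosen (Equivalence.from (selected⇔unkilled (index z))
    λ (r , r<z , Sr , Rrz) → unkilled {element r}
      (subst (_< index z) (sym (strictlyInverseˡ r)) r<z)
      (chosen (subst (T ∘ selected) (sym (strictlyInverseˡ r)) Sr))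
      (subst (R (element r)) (strictlyInverseʳ z) Rrz))

  selected-maximal : ∀ {z} → ¬ Selected z → ∃ λ w → Selected w × R w z
  selected-maximal {z} ¬Sz with killed? selected (index z)
  ... | yes (r , _ , Sr , Rrz) = element r ,
    chosen (subst (T ∘ selected) (sym (strictlyInverseˡ r)) Sr) , subst (R (element r)) (strictlyInverseʳ z) Rrz
  ... | no unkilled = contradiction (selected-intro λ w<z Sw Rwz → unkilled (killer w<z Sw Rwz)) ¬Sz

pos-part : ℤ → ℕ
pos-part (+ n)    = n
pos-part -[1+ n ] = 0

neg-part : ℤ → ℕ
neg-part (+ n)    = 0
neg-part -[1+ n ] = suc n

pos-part-neg-part : ∀ z → z ℤ.+ + neg-part z ≡ + pos-part z
pos-part-neg-part (+ n)    = ℤ.+-identityʳ (+ n)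
pos-part-neg-part -[1+ n ] = ℤ.n⊖n≡0 (suc n)

pos-+³ : ∀ x y z → + (x + y + z) ≡ + x ℤ.+ + y ℤ.+ + z
pos-+³ x y z = trans (ℤ.pos-+ (x + y) z) (cong (ℤ._+ + z) (ℤ.pos-+ x y))

+-[-]-cancel : ∀ x w → x ℤ.+ (w ℤ.- x) ≡ w
+-[-]-cancel = solve-∀

shifted⇒ℕ : ∀ {z w x y} → z ≡ + x ℤ.+ (w ℤ.- + y) →
            pos-part z + y + neg-part w ≡ x + pos-part w + neg-part z
shifted⇒ℕ {z} {w} {x} {y} z≡ = ℤ.+-injective (begin
  + (pos-part z + y + neg-part w)                   ≡⟨ pos-+³ (pos-part z) y (neg-part w) ⟩
  + pos-part z ℤ.+ + y ℤ.+ + neg-part w             ≡⟨ cong (λ u → u ℤ.+ + y ℤ.+ + neg-part w) (sym (pos-part-neg-part z)) ⟩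
  z ℤ.+ + neg-part z ℤ.+ + y ℤ.+ + neg-part w        ≡⟨ cong (λ u → u ℤ.+ + neg-part z ℤ.+ + y ℤ.+ + neg-part w) z≡ ⟩
  + x ℤ.+ (w ℤ.- + y) ℤ.+ + neg-part z ℤ.+ + y ℤ.+ + neg-part w ≡⟨ rearrange (+ x) w (+ y) (+ neg-part z) (+ neg-part w) ⟩
  + x ℤ.+ (w ℤ.+ + neg-part w) ℤ.+ + neg-part z      ≡⟨ cong (λ u → + x ℤ.+ u ℤ.+ + neg-part z) (pos-part-neg-part w) ⟩
  + x ℤ.+ + pos-part w ℤ.+ + neg-part z              ≡⟨ sym (pos-+³ x (pos-part w) (neg-part z)) ⟩
  + (x + pos-part w + neg-part z)                   ∎)
  where
  open ≡-Reasoning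
  rearrange : ∀ x w y m n → x ℤ.+ (w ℤ.- y) ℤ.+ m ℤ.+ y ℤ.+ n ≡ x ℤ.+ (w ℤ.+ n) ℤ.+ m
  rearrange = solve-∀

<-∣∣-of-pos : ∀ {n} z → n + neg-part z < pos-part z → n < ∣ z ∣
<-∣∣-of-pos {n} (+ s)    lt = subst (_< s) (+-identityʳ n) lt
<-∣∣-of-pos     -[1+ s ] ()

<-∣∣-of-neg : ∀ {n} z → pos-part z + n < neg-part z → n < ∣ z ∣
<-∣∣-of-neg (+ s)    ()
<-∣∣-of-neg -[1+ s ] lt = lt

Range : (ℕ → ℕ) → Subset
Range a z = ∃ λ i → z ≡ + a i

module IncreasingGaps
  (a E : ℕ → ℕ)
  (a-step : ∀ j → a (suc j) ≡ a j + E j)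
  (E-mono : ∀ j → E j ≤ E (suc j))
  (j<E : ∀ j → j < E j)
  where

  a-gap : ∀ {i j} → i < j → a i + E i ≤ a j
  a-gap {i} {suc j} (s≤s i≤j) with m≤n⇒m<n∨m≡n i≤j
  ... | inj₁ i<j  = ≤-trans (a-gap i<j) (subst (a j ≤_) (sym (a-step j)) (m≤m+n (a j) (E j)))
  ... | inj₂ refl = ≤-reflexive (sym (a-step i))

  a-mono-< : ∀ {i j} → i < j → a i < a j
  a-mono-< {i} i<j = <-≤-trans (m<m+n (a i) (≤-<-trans z≤n (j<E i))) (a-gap i<j)

  a-mono-≤ : ∀ {i j} → i ≤ j → a i ≤ a j
  a-mono-≤ i≤j with m≤n⇒m<n∨m≡n i≤j
  ... | inj₁ i<j  = <⇒≤ (a-mono-< i<j)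
  ... | inj₂ refl = ≤-refl

  i≤a : ∀ i → i ≤ a i
  i≤a zero    = z≤n
  i≤a (suc i) = ≤-<-trans (i≤a i) (a-mono-< (n<1+n i))

  E-mono-≤ : ∀ {i j} → i ≤ j → E i ≤ E j
  E-mono-≤ {j = zero} z≤n = ≤-refl
  E-mono-≤ {i} {suc j} i≤1+j with m≤n⇒m<n∨m≡n i≤1+j
  ... | inj₁ (s≤s i≤j) = ≤-trans (E-mono-≤ i≤j) (E-mono j)
  ... | inj₂ refl      = ≤-refl

  private
    leastGapAbove : ∀ x → ∃ λ k → x < E k × (∀ {j} → x < E j → k ≤ j)
    leastGapAbove x = least (λ j → x <? E j) x (j<E x)

  opaque
    gapIndex : ℕ → ℕ
    gapIndex x = proj₁ (leastGapAbove x)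

    gapIndex-above : ∀ x → x < E (gapIndex x)
    gapIndex-above x = proj₁ (proj₂ (leastGapAbove x))

    gapIndex-≤ : ∀ {x j} → x < E j → gapIndex x ≤ j
    gapIndex-≤ {x} = proj₂ (proj₂ (leastGapAbove x))

  gapIndex-below : ∀ {x j} → j < gapIndex x → E j ≤ x
  gapIndex-below j<g = ≮⇒≥ λ x<Ej → <⇒≱ j<g (gapIndex-≤ x<Ej)

  gapIndex-mono : ∀ {x y} → x ≤ y → gapIndex x ≤ gapIndex y
  gapIndex-mono {y = y} x≤y = gapIndex-≤ (≤-<-trans x≤y (gapIndex-above y))

  gapIndex-≡ : ∀ {x k} → E k ≤ x → x < E (suc k) → gapIndex x ≡ suc k
  gapIndex-≡ {x} Ek≤x x<E = ≤-antisym (gapIndex-≤ x<E)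
    (≮⇒≥ λ g<1+k → <⇒≱ (gapIndex-above x) (≤-trans (E-mono-≤ (s≤s⁻¹ g<1+k)) Ek≤x))

  -- 2 ∣w∣ < E (anchor w) is what makes covering increase ∣·∣ (covers⇒∣∣<).
  anchor : ℤ → ℕ
  anchor (+ _)    = 0
  anchor -[1+ m ] = gapIndex (2 * suc m)

  opaque
    shift : ℤ → ℤ
    shift w = w ℤ.- + a (anchor w)

    +-shift : ∀ w → + a (anchor w) ℤ.+ shift w ≡ w
    +-shift w = +-[-]-cancel (+ a (anchor w)) w

    covers⇒ℕ : ∀ {w z i} → z ≡ + a i ℤ.+ shift w →
               pos-part z + a (anchor w) + neg-part w ≡ a i + pos-part w + neg-part z
    covers⇒ℕ = shifted⇒ℕ

  Covers : ℤ → ℤ → Set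
  Covers w z = ∃ λ i → i ≢ anchor w × z ≡ + a i ℤ.+ shift w

  covers? : ∀ w z → Dec (Covers w z)
  covers? w z = map′ (λ (i , _ , cov) → i , cov) (λ (i , cov) → i , bound cov , cov)
    (anyUpTo? (λ i → ¬? (i ≟ anchor w) ×-dec (z ℤ.≟ + a i ℤ.+ shift w))
              (suc (pos-part z + a (anchor w) + neg-part w)))
    where
    bound : ∀ {i} → i ≢ anchor w × z ≡ + a i ℤ.+ shift w →
            i < suc (pos-part z + a (anchor w) + neg-part w)
    bound {i} (_ , z≡) = s≤s (begin
      i                                   ≤⟨ i≤a i ⟩
      a i                                 ≤⟨ m≤m+n (a i) (pos-part w) ⟩
      a i + pos-part w                    ≤⟨ m≤m+n (a i + pos-part w) (neg-part z) ⟩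
      a i + pos-part w + neg-part z       ≡⟨ sym (covers⇒ℕ z≡) ⟩
      pos-part z + a (anchor w) + neg-part w ∎)
      where open ≤-Reasoning

  covers-sign : ∀ {w z i} → i ≢ anchor w → z ≡ + a i ℤ.+ shift w →
                (∣ w ∣ + neg-part z < pos-part z) ⊎ (pos-part z + ∣ w ∣ < neg-part z × i < anchor w)
  covers-sign {+ p} {z} {i} i≢0 z≡ =
    inj₁ (above {pos-part z} (a-mono-< (n≢0⇒n>0 i≢0)) (covers⇒ℕ {+ p} {z} {i} z≡))
    where
    above : ∀ {P x y c N} → x < y → P + x + 0 ≡ y + c + N → c + N < P
    above {P} {x} {y} {c} {N} x<y eq = +-cancelʳ-< x (c + N) P (begin-strict
      c + N + x  <⟨ +-monoʳ-< (c + N) x<y ⟩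
      c + N + y  ≡⟨ solve (c ∷ N ∷ y ∷ []) ⟩
      y + c + N  ≡⟨ sym eq ⟩
      P + x + 0  ≡⟨ +-identityʳ (P + x) ⟩
      P + x      ∎)
      where open ≤-Reasoning
  covers-sign { -[1+ m ]} {z} {i} i≢K z≡ with <-cmp i (anchor -[1+ m ])
  ... | tri< i<K _ _ =
    inj₂ (below {pos-part z} {M = suc m} (a-mono-< i<K) (covers⇒ℕ { -[1+ m ]} {z} {i} z≡) , i<K)
    where
    below : ∀ {P x y M N} → y < x → P + x + M ≡ y + 0 + N → P + M < N
    below {P} {x} {y} {M} {N} y<x eq = +-cancelʳ-< y (P + M) N (begin-strict
      P + M + y  <⟨ +-monoʳ-< (P + M) y<x ⟩
      P + M + x  ≡⟨ solve (P ∷ M ∷ x ∷ []) ⟩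
      P + x + M  ≡⟨ eq ⟩
      y + 0 + N  ≡⟨ solve (y ∷ N ∷ []) ⟩
      N + y      ∎)
      where open ≤-Reasoning
  ... | tri≈ _ i≡K _ = ⊥-elim (i≢K i≡K)
  ... | tri> _ _ K<i = inj₁ (beyond {pos-part z} {M = suc m}
    (a-gap K<i) (gapIndex-above (2 * suc m)) (covers⇒ℕ { -[1+ m ]} {z} {i} z≡))
    where
    beyond : ∀ {P x y M N F} → x + F ≤ y → 2 * M < F → P + x + M ≡ y + 0 + N → M + N < P
    beyond {P} {x} {y} {M} {N} {F} x+F≤y 2M<F eq = +-cancelʳ-< (x + M) (M + N) P (begin-strict
      M + N + (x + M)  ≡⟨ solve (M ∷ N ∷ x ∷ []) ⟩
      x + 2 * M + N    <⟨ +-monoˡ-< N (+-monoʳ-< x 2M<F) ⟩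
      x + F + N        ≤⟨ +-monoˡ-≤ N x+F≤y ⟩
      y + N            ≡⟨ solve (y ∷ N ∷ []) ⟩
      y + 0 + N        ≡⟨ sym eq ⟩
      P + x + M        ≡⟨ +-assoc P x M ⟩
      P + (x + M)      ∎)
      where open ≤-Reasoning

  covers⇒∣∣< : ∀ {w z} → Covers w z → ∣ w ∣ < ∣ z ∣
  covers⇒∣∣< {w} {z} (_ , i≢ , z≡) with covers-sign {w} i≢ z≡
  ... | inj₁ lt       = <-∣∣-of-pos z lt
  ... | inj₂ (lt , _) = <-∣∣-of-neg z lt

  covers⇒rank< : ∀ {w z} → Covers w z → rank w < rank z
  covers⇒rank< {w} {z} cover = rank-mono-∣∣ {w} {z} (covers⇒∣∣< {w} {z} cover)

  open Greedy ℤ↔ℕ covers?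

  B : Subset
  B b = ∃ λ w → Selected w × b ≡ shift w

  selected-uncovered : ∀ {t w} → Selected t → Selected w → ¬ Covers w t
  selected-uncovered {t} {w} St Sw cover = selected-free St (covers⇒rank< {w} {t} cover) Sw cover

  selected-representation : ∀ {t w i} → Selected t → Selected w → t ≡ + a i ℤ.+ shift w →
                            i ≡ anchor w × t ≡ w
  selected-representation {t} {w} {i} St Sw t≡ with i ≟ anchor w
  ... | yes refl = refl , trans t≡ (+-shift w)
  ... | no i≢    = ⊥-elim (selected-uncovered St Sw (i , i≢ , t≡))

  uncovered⇒selected : ∀ {z} → (∀ {w} → ¬ Covers w z) → Selected z
  uncovered⇒selected uncovered = selected-intro λ {w} _ _ → uncovered {w}

  zero-selected : Selected (+ 0)
  zero-selected = uncovered⇒selected λ {w} cover → n≮0 (covers⇒∣∣< {w} {+ 0} cover)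

  -- −Q is covered by no −q with 0 < q < Q.
  Isolated : ℕ → Set
  Isolated Q = ∀ {q i} → 0 < q → q < Q → i < gapIndex (2 * q) → q + a (gapIndex (2 * q)) ≢ Q + a i

  isolated-far : ∀ {q Q i} → let K = gapIndex (2 * q) in
                 E K + 2 * a K ≤ 2 * Q + 2 * a 0 → q + a K ≢ Q + a i
  isolated-far {q} {Q} {i} bound eq = <⇒≱ (begin-strict
    2 * Q + 2 * a 0  ≤⟨ +-monoʳ-≤ (2 * Q) (*-monoʳ-≤ 2 (a-mono-≤ z≤n)) ⟩
    2 * Q + 2 * a i  ≡⟨ sym (*-distribˡ-+ 2 Q (a i)) ⟩
    2 * (Q + a i)    ≡⟨ cong (2 *_) (sym eq) ⟩
    2 * (q + a K)    ≡⟨ *-distribˡ-+ 2 q (a K) ⟩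
    2 * q + 2 * a K  <⟨ +-monoˡ-< (2 * a K) (gapIndex-above (2 * q)) ⟩
    E K + 2 * a K    ∎) bound
    where
    open ≤-Reasoning
    K = gapIndex (2 * q)

  isolated-near : ∀ {q Q K i} → gapIndex (2 * q) ≡ suc K → i < gapIndex (2 * q) → 2 * Q < 3 * E K →
                  q + a (gapIndex (2 * q)) ≢ Q + a i
  isolated-near {q} {Q} {K} {i} g≡ i<g 2Q<3E =
    subst (λ k → q + a k ≢ Q + a i) (sym g≡) (near (subst (i <_) g≡ i<g))
    where
    open ≤-Reasoning
    near : i < suc K → q + a (suc K) ≢ Q + a i
    near i<1+K eq = <⇒≱ 2Q<3E (begin
      3 * E K          ≤⟨ +-monoˡ-≤ (2 * E K) (gapIndex-below (subst (K <_) (sym g≡) (n<1+n K))) ⟩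
      2 * q + 2 * E K  ≡⟨ sym (*-distribˡ-+ 2 q (E K)) ⟩
      2 * (q + E K)    ≤⟨ *-monoʳ-≤ 2 q+E≤Q ⟩
      2 * Q            ∎)
      where
      q+E≤Q : q + E K ≤ Q
      q+E≤Q = +-cancelʳ-≤ (a K) (q + E K) Q (begin
        q + E K + a K    ≡⟨ trans (+-assoc q (E K) (a K)) (cong (λ x → q + x) (+-comm (E K) (a K))) ⟩
        q + (a K + E K)  ≡⟨ cong (λ x → q + x) (sym (a-step K)) ⟩
        q + a (suc K)    ≡⟨ eq ⟩
        Q + a i          ≤⟨ +-monoʳ-≤ Q (a-mono-≤ (s≤s⁻¹ i<1+K)) ⟩
        Q + a K          ∎)

  isolated⇒selected : ∀ {Q} → Isolated (suc Q) → Selected -[1+ Q ]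
  isolated⇒selected {Q} isolated = uncovered⇒selected λ {w} → uncovered {w}
    where
    uncovered : ∀ {w} → ¬ Covers w -[1+ Q ]
    uncovered {+ p} (i , i≢ , z≡) with covers-sign {+ p} i≢ z≡
    ... | inj₁ ()
    ... | inj₂ (_ , ())
    uncovered { -[1+ m ]} (i , i≢ , z≡) with covers-sign { -[1+ m ]} i≢ z≡
    ... | inj₁ ()
    ... | inj₂ (m<Q , i<K) = isolated (s≤s z≤n) m<Q i<K (begin
      suc m + a K       ≡⟨ +-comm (suc m) (a K) ⟩
      a K + suc m       ≡⟨ covers⇒ℕ { -[1+ m ]} z≡ ⟩
      a i + 0 + suc Q   ≡⟨ cong (_+ suc Q) (+-identityʳ (a i)) ⟩
      a i + suc Q       ≡⟨ +-comm (a i) (suc Q) ⟩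
      suc Q + a i       ∎)
      where
      open ≡-Reasoning
      K = anchor -[1+ m ]

  EveryLevelIsolated : Set
  EveryLevelIsolated = ∀ k → ∃ λ Q → gapIndex (2 * Q) ≡ suc k × Isolated Q

  selected-with-anchor : EveryLevelIsolated → ∀ k → ∃ λ t → Selected t × anchor t ≡ k
  selected-with-anchor _ zero = + 0 , zero-selected , refl
  selected-with-anchor isolating (suc k) with isolating k
  ... | zero  , g≡ , _   = contradiction (subst (_≤ 0) g≡ (gapIndex-≤ (j<E 0))) λ ()
  ... | suc Q , g≡ , iso = -[1+ Q ] , isolated⇒selected iso , g≡

  coMinimalPartner : EveryLevelIsolated → Σ Subset (CoMinimalPair (Range a))
  coMinimalPartner isolating = B ,
    (+ a 0 , 0 , refl) , (shift (+ 0) , + 0 , zero-selected , refl) , sumset , A-minimal , B-minimal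
    where
    sumset : SumsetIsℤ (Range a) B
    sumset z with selected? z
    ... | yes Sz = + a (anchor z) , shift z , (anchor z , refl) , (z , Sz , refl) ,
                   sym (+-shift z)
    ... | no ¬Sz with selected-maximal ¬Sz
    ...   | w , Sw , i , _ , z≡ = + a i , shift w , (i , refl) , (w , Sw , refl) , z≡

    A-minimal : ∀ A' → Nonempty A' → A' ⊊ Range a → ¬ SumsetIsℤ A' B
    A-minimal A' _ (A'⊆ , _ , (k , refl) , ak∉A') sum with selected-with-anchor isolating k
    ... | t , St , refl with sum t
    ... | x , _ , A'x , (w , Sw , refl) , t≡ with A'⊆ x A'x
    ... | i , refl with selected-representation St Sw t≡
    ... | refl , refl = ak∉A' A'x

    B-minimal : ∀ B' → Nonempty B' → B' ⊊ B → ¬ SumsetIsℤ (Range a) B'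
    B-minimal B' _ (B'⊆ , _ , (t , St , refl) , b∉B') sum with sum t
    ... | _ , b , (i , refl) , B'b , t≡ with B'⊆ b B'b
    ... | w , Sw , refl with selected-representation St Sw t≡
    ... | _ , refl = b∉B' B'b

n<m^n : ∀ {m} → 1 < m → ∀ n → n < m ^ n
n<m^n 1<m zero    = s≤s z≤n
n<m^n {m} 1<m (suc n) = ≤-<-trans (n<m^n 1<m n) (^-monoʳ-< m 1<m (n<1+n n))

≤-offset : ∀ {m n} d → m + d ≡ n → m ≤ n
≤-offset {m} d refl = m≤m+n m d

module PowerSequence (m : ℕ) where

  E : ℕ → ℕ
  E j = (2 + m) * (3 + m) ^ j

  E-mono : ∀ j → E j ≤ E (suc j)
  E-mono j = *-monoʳ-≤ (2 + m) (m≤n*m ((3 + m) ^ j) (3 + m))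

  j<E : ∀ j → j < E j
  j<E j = <-≤-trans (n<m^n (s≤s (s≤s z≤n)) j) (m≤n*m ((3 + m) ^ j) (2 + m))

  open IncreasingGaps ((3 + m) ^_) E (λ _ → refl) E-mono j<E public

  module _ {N Q : ℕ} (1≤N : 1 ≤ N) (Q+1≡ : suc Q ≡ (3 + m) * N) where

    2Q+2≡ : 2 * Q + 2 ≡ 2 * ((3 + m) * N)
    2Q+2≡ = trans (+-comm (2 * Q) 2) (trans (sym (*-suc 2 Q)) (cong (2 *_) Q+1≡))

    E[k]≤2Q : (2 + m) * N ≤ 2 * Q
    E[k]≤2Q = +-cancelʳ-≤ 2 ((2 + m) * N) (2 * Q) (begin
      (2 + m) * N + 2              ≤⟨ +-monoʳ-≤ ((2 + m) * N) (≤-trans (*-monoʳ-≤ 2 1≤N) (m≤m+n (2 * N) ((2 + m) * N))) ⟩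
      (2 + m) * N + (2 * N + (2 + m) * N) ≡⟨ solve (m ∷ N ∷ []) ⟩
      2 * ((3 + m) * N)            ≡⟨ sym 2Q+2≡ ⟩
      2 * Q + 2                    ∎)
      where open ≤-Reasoning

    2Q<2[Q+1] : 2 * Q < 2 * ((3 + m) * N)
    2Q<2[Q+1] = subst (2 * Q <_) 2Q+2≡ (m<m+n (2 * Q) (s≤s z≤n))

    2Q<E[k+1] : 2 * Q < (2 + m) * ((3 + m) * N)
    2Q<E[k+1] = <-≤-trans 2Q<2[Q+1] (*-monoˡ-≤ ((3 + m) * N) (s≤s (s≤s (z≤n {m}))))

    2Q<3E[k] : 2 * Q < 3 * ((2 + m) * N)
    2Q<3E[k] = begin-strict
      2 * Q                <⟨ 2Q<2[Q+1] ⟩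
      2 * ((3 + m) * N)    ≡⟨ solve (m ∷ N ∷ []) ⟩
      6 * N + 2 * m * N    ≤⟨ +-monoʳ-≤ (6 * N) (*-monoˡ-≤ N (*-monoˡ-≤ m (n≤1+n 2))) ⟩
      6 * N + 3 * m * N    ≡⟨ solve (m ∷ N ∷ []) ⟩
      3 * ((2 + m) * N)    ∎
      where open ≤-Reasoning

    far-bound : ∀ {P} → P ≤ N → (2 + m) * P + 2 * P ≤ 2 * Q + 2
    far-bound {P} P≤N = begin
      (2 + m) * P + 2 * P          ≡⟨ solve (m ∷ P ∷ []) ⟩
      (4 + m) * P                  ≤⟨ *-monoʳ-≤ (4 + m) P≤N ⟩
      (4 + m) * N                  ≤⟨ m≤n+m ((4 + m) * N) ((2 + m) * N) ⟩
      (2 + m) * N + (4 + m) * N    ≡⟨ solve (m ∷ N ∷ []) ⟩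
      2 * ((3 + m) * N)            ≡⟨ sym 2Q+2≡ ⟩
      2 * Q + 2                    ∎
      where open ≤-Reasoning

  isolating : EveryLevelIsolated
  isolating k = Q , gapIndex-2Q , isolated
    where
    N = (3 + m) ^ k
    Q = pred ((3 + m) * N)
    1≤N : 1 ≤ N
    1≤N = m^n>0 (3 + m) k
    Q+1≡ : suc Q ≡ (3 + m) * N
    Q+1≡ = suc-pred ((3 + m) * N) {{m^n≢0 (3 + m) (suc k)}}
    gapIndex-2Q : gapIndex (2 * Q) ≡ suc k
    gapIndex-2Q = gapIndex-≡ (E[k]≤2Q 1≤N Q+1≡) (2Q<E[k+1] 1≤N Q+1≡)
    isolated : Isolated Q
    isolated {q} {i} _ q<Q i<K
      with m≤n⇒m<n∨m≡n (subst (gapIndex (2 * q) ≤_) gapIndex-2Q (gapIndex-mono (*-monoʳ-≤ 2 (<⇒≤ q<Q))))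
    ... | inj₁ (s≤s K≤k) = isolated-far {q} {Q} {i} (far-bound 1≤N Q+1≡ (^-monoʳ-≤ (3 + m) K≤k))
    ... | inj₂ K≡1+k     = isolated-near {q} {Q} {k} {i} K≡1+k i<K (2Q<3E[k] 1≤N Q+1≡)

module ShiftedPowersOfTwo where

  a : ℕ → ℕ
  a k = 2 ^ k + k

  E : ℕ → ℕ
  E j = 2 ^ j + 1

  a-step : ∀ j → a (suc j) ≡ a j + E j
  a-step j = doubling (2 ^ j) j
    where
    doubling : ∀ x y → 2 * x + suc y ≡ x + y + (x + 1)
    doubling x y = solve (x ∷ y ∷ [])

  E-mono : ∀ j → E j ≤ E (suc j)
  E-mono j = +-monoˡ-≤ 1 (m≤n*m (2 ^ j) 2)

  j<E : ∀ j → j < E j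
  j<E j = <-≤-trans (n<m^n (s≤s (s≤s z≤n)) j) (m≤m+n (2 ^ j) 1)

  open IncreasingGaps a E a-step E-mono j<E public

  2j≤2^j+2 : ∀ j → 2 * j ≤ 2 ^ j + 2
  2j≤2^j+2 zero          = z≤n
  2j≤2^j+2 (suc zero)    = s≤s (s≤s z≤n)
  2j≤2^j+2 (suc (suc j)) = begin
    2 * (2 + j)            ≡⟨ solve (j ∷ []) ⟩
    2 * (1 + j) + 2        ≤⟨ +-monoˡ-≤ 2 (2j≤2^j+2 (suc j)) ⟩
    2 ^ suc j + 2 + 2      ≤⟨ +-monoʳ-≤ (2 ^ suc j + 2) (*-monoʳ-≤ 2 (m^n>0 2 j)) ⟩
    2 ^ suc j + 2 + 2 * 2 ^ j ≡⟨ regroup (2 ^ j) ⟩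
    2 ^ suc (suc j) + 2    ∎
    where
    open ≤-Reasoning
    regroup : ∀ x → 2 * x + 2 + 2 * x ≡ 2 * (2 * x) + 2
    regroup x = solve (x ∷ [])

  isolating : EveryLevelIsolated
  isolating zero          = 1 , gapIndex-≡ ≤-refl ≤-refl , λ { (s≤s _) (s≤s ()) _ }
  isolating (suc zero)    = 2 , gapIndex-≡ (≤-offset 1 refl) ≤-refl , isolated
    where
    isolated : Isolated 2
    isolated {suc zero} {i} _ _ i<K =
      isolated-near {1} {2} {0} {i} (gapIndex-≡ ≤-refl ≤-refl) i<K (≤-offset 1 refl)
    isolated {suc (suc _)} _ (s≤s (s≤s ())) _
  isolating (suc (suc j)) = Q , gapIndex-2Q , isolated
    where
    p = 2 ^ j
    Q = 2 * p + 2
    1≤p : 1 ≤ p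
    1≤p = m^n>0 2 j

    E[j+2]≤2Q : ∀ x → 2 * (2 * x) + 1 ≤ 2 * (2 * x + 2)
    E[j+2]≤2Q x = ≤-offset 3 (solve (x ∷ []))

    2Q<E[j+3] : ∀ {x} → 1 ≤ x → 2 * (2 * x + 2) < 2 * (2 * (2 * x)) + 1
    2Q<E[j+3] {suc x} _ = ≤-offset (4 * x) (solve (x ∷ []))

    2Q<3E[j+2] : ∀ {x} → 1 ≤ x → 2 * (2 * x + 2) < 3 * (2 * (2 * x) + 1)
    2Q<3E[j+2] {suc x} _ = ≤-offset (8 * x + 6) (solve (x ∷ []))

    2Q<3E[j+1] : ∀ {x} → 1 ≤ x → 2 * (2 * x + 2) < 3 * (2 * x + 1)
    2Q<3E[j+1] {suc x} _ = ≤-offset (2 * x) (solve (x ∷ []))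

    gapIndex-2Q : gapIndex (2 * Q) ≡ 3 + j
    gapIndex-2Q = gapIndex-≡ (E[j+2]≤2Q p) (2Q<E[j+3] 1≤p)

    gapIndex-2q≤ : ∀ {q} → q < Q → gapIndex (2 * q) ≤ 3 + j
    gapIndex-2q≤ {q} q<Q = subst (gapIndex (2 * q) ≤_) gapIndex-2Q (gapIndex-mono (*-monoʳ-≤ 2 (<⇒≤ q<Q)))

    far-bound : ∀ {P K} → P ≤ p → K ≤ j → (P + 1) + 2 * (P + K) ≤ 2 * Q + 2
    far-bound {P} {K} P≤p K≤j = begin
      (P + 1) + 2 * (P + K)  ≡⟨ solve (P ∷ K ∷ []) ⟩
      3 * P + 2 * K + 1      ≤⟨ +-monoˡ-≤ 1 (+-mono-≤ (*-monoʳ-≤ 3 P≤p) (*-monoʳ-≤ 2 K≤j)) ⟩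
      3 * p + 2 * j + 1      ≤⟨ +-monoˡ-≤ 1 (+-monoʳ-≤ (3 * p) (2j≤2^j+2 j)) ⟩
      3 * p + (p + 2) + 1    ≤⟨ ≤-offset 3 (4p+6 p) ⟩
      2 * Q + 2              ∎
      where
      open ≤-Reasoning
      4p+6 : ∀ x → 3 * x + (x + 2) + 1 + 3 ≡ 2 * (2 * x + 2) + 2
      4p+6 x = solve (x ∷ [])

    isolated-at-j+1 : ∀ {q i} → gapIndex (2 * q) ≡ suc j → i < gapIndex (2 * q) →
                      q + a (gapIndex (2 * q)) ≢ Q + a i
    isolated-at-j+1 {q} {i} g≡ i<g =
      subst (λ k → q + a k ≢ Q + a i) (sym g≡) (middle (s≤s⁻¹ (subst (i <_) g≡ i<g)))
      where
      2q<E : 2 * q < 2 * p + 1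
      2q<E = subst (λ k → 2 * q < E k) g≡ (gapIndex-above (2 * q))
      E≤2q : p + 1 ≤ 2 * q
      E≤2q = gapIndex-below (subst (j <_) (sym g≡) (n<1+n j))
      middle : i ≤ j → q + a (suc j) ≢ Q + a i
      middle i≤j eq with m≤n⇒m<n∨m≡n i≤j
      ... | inj₂ refl = <⇒≱ 2q<E (subst (2 * p + 1 ≤_) (cong (2 *_) (sym q≡p+1)) (≤-offset 1 (double p)))
        where
        shuffle : ∀ x y → 2 * x + 2 + (x + y) ≡ x + 1 + (2 * x + suc y)
        shuffle x y = solve (x ∷ y ∷ [])
        double : ∀ x → 2 * x + 1 + 1 ≡ 2 * (x + 1)
        double x = solve (x ∷ [])
        q≡p+1 : q ≡ p + 1
        q≡p+1 = +-cancelʳ-≡ (2 * p + suc j) q (p + 1) (trans eq (shuffle p j))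
      ... | inj₁ i<j = <⇒≱ (≤-<-trans 2q≤p (n<1+n p)) (subst (_≤ 2 * q) (+-comm p 1) E≤2q)
        where
        open ≤-Reasoning
        shuffle : ∀ x y z → 2 * x + (y + suc z) ≡ y + (2 * x + suc z)
        shuffle x y z = solve (x ∷ y ∷ z ∷ [])
        q+j+1≡ : q + suc j ≡ 2 + a i
        q+j+1≡ = +-cancelˡ-≡ (2 * p) (q + suc j) (2 + a i)
          (trans (shuffle p q j) (trans eq (+-assoc (2 * p) 2 (a i))))
        expand : ∀ x y → 2 * (2 + (x + y)) ≡ 2 * x + (2 * suc y + 2)
        expand x y = solve (x ∷ y ∷ [])
        2q≤p : 2 * q ≤ p
        2q≤p = +-cancelʳ-≤ (2 * j + 2) (2 * q) p (begin
          2 * q + (2 * j + 2)         ≡⟨ solve (q ∷ j ∷ []) ⟩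
          2 * (q + suc j)             ≡⟨ cong (2 *_) q+j+1≡ ⟩
          2 * (2 + (2 ^ i + i))       ≡⟨ expand (2 ^ i) i ⟩
          2 * 2 ^ i + (2 * suc i + 2) ≤⟨ +-mono-≤ (^-monoʳ-≤ 2 i<j) (+-monoˡ-≤ 2 (*-monoʳ-≤ 2 i<j)) ⟩
          p + (2 * j + 2)             ∎)

    isolated : Isolated Q
    isolated {q} {i} _ q<Q i<K with m≤n⇒m<n∨m≡n (gapIndex-2q≤ q<Q)
    ... | inj₂ K≡j+3 = isolated-near {q} {Q} {2 + j} {i} K≡j+3 i<K (2Q<3E[j+2] 1≤p)
    ... | inj₁ (s≤s K≤j+2) with m≤n⇒m<n∨m≡n K≤j+2
    ...   | inj₂ K≡j+2 = isolated-near {q} {Q} {1 + j} {i} K≡j+2 i<K (2Q<3E[j+1] 1≤p)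
    ...   | inj₁ (s≤s K≤j+1) with m≤n⇒m<n∨m≡n K≤j+1
    ...     | inj₂ K≡j+1    = isolated-at-j+1 {q} {i} K≡j+1 i<K
    ...     | inj₁ (s≤s K≤j) = isolated-far {q} {Q} {i} (far-bound (^-monoʳ-≤ 2 K≤j) K≤j)

powers-coMinimal : ∀ m → Σ Subset (CoMinimalPair (Powers (3 + m)))
powers-coMinimal m = coMinimalPartner isolating
  where open PowerSequence m

powersOfTwoPlusIndex-coMinimal : Σ Subset (CoMinimalPair PowersOfTwoPlusIndex)
powersOfTwoPlusIndex-coMinimal = coMinimalPartner isolating
  where open ShiftedPowersOfTwo

corollary3p4 : ((n : ℕ) → n ≥ 3 → Σ Subset (λ S → CoMinimalPair (Powers n) S))
    × Σ Subset (λ S → CoMinimalPair PowersOfTwoPlusIndex S)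
corollary3p4 = powers , powersOfTwoPlusIndex-coMinimal
  where
  powers : (n : ℕ) → n ≥ 3 → Σ Subset (λ S → CoMinimalPair (Powers n) S)
  powers _ (s≤s (s≤s (s≤s {n = m} _))) = powers-coMinimal m
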